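{- Let $G=(A,B,E)$ be a bistable bipartite graph with at least $4$ vertices. Then the intersection of all perfect matchings of $G$ is empty.
   Context: All graphs are finite and simple. A maximum stable set is a set of pairwise nonadjacent vertices of largest possible size. A bipartite graph $G=(A,B,E)$ is bistable if $A$ and $B$ are exactly its two maximum stable sets. A perfect matching is a set of pairwise non-incident edges covering all vertices; perfect matchings are regarded as edge sets. -}

module Defs where

open import Data.Nat using (ℕ; _≤_)
open import Data.Fin using (Fin)
open import Data.Fin.Subset using (Subset; _∈_; _∉_; ∣_∣)
open import Data.Bool using (Bool; true)
open import Data.Product using (_×_; ∃)
open import Data.Sum using (_⊎_)
open import Relation.Binary.PropositionalEquality using (_≡_)
open import Relation.Nullary using (¬_)

record Graph (n : ℕ) : Set where
  field
    adj     : Fin n → Fin n → Bool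
    sym     : ∀ u v → adj u v ≡ true → adj v u ≡ true
    irrefl  : ∀ v → ¬ (adj v v ≡ true)
open Graph public

Stable : ∀ {n} → Graph n → Subset n → Set
Stable G S = ∀ u v → u ∈ S → v ∈ S → ¬ (adj G u v ≡ true)

MaximumStable : ∀ {n} → Graph n → Subset n → Set
MaximumStable G S = Stable G S × (∀ T → Stable G T → ∣ T ∣ ≤ ∣ S ∣)

IsBipartition : ∀ {n} → Graph n → Subset n → Subset n → Set
IsBipartition {n} G A B =
  (∀ (v : Fin n) → v ∈ A ⊎ v ∈ B) × (∀ (v : Fin n) → v ∈ A → v ∉ B)
  × Stable G A × Stable G B

Bistable : ∀ {n} → Graph n → Subset n → Subset n → Set
Bistable G A B =
  MaximumStable G A × MaximumStable G B
  × (∀ S → MaximumStable G S → S ≡ A ⊎ S ≡ B)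

-- An edge set, given as a symmetric Bool-valued relation
-- ({u,v} ∈ M iff M u v ≡ true).
PerfectMatching : ∀ {n} → Graph n → (Fin n → Fin n → Bool) → Set
PerfectMatching {n} G M =
  (∀ u v → M u v ≡ true → M v u ≡ true)
  × (∀ u v → M u v ≡ true → adj G u v ≡ true)
  × (∀ (v : Fin n) → ∃ λ u → M v u ≡ true × (∀ w → M v w ≡ true → w ≡ u))

-- Deleting the edge uv keeps the stability number at ∣A∣ = n/2: a stable set T of G − uv with more
-- than ∣A∣ vertices contains u and v, and then T − v and T − u are distinct maximum stable sets of
-- G, hence A and B; so T is everything and n = ∣A∣ + 1 = 2∣A∣ ≤ 2. By König's theorem (a balanced
-- bipartite graph with α = n/2 has a perfect matching, proved by strong induction on the side size
-- k: either some stable set of size k misses vertices on both sides and splits the vertex set in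
-- two, or else any edge ab can be matched and α drops by one on the rest), G − uv has a perfect
-- matching, and it avoids uv.
module Submission where

open import Defs hiding (sym)
open import Data.Bool as Bool using (Bool; true; false; _∧_; _∨_; not)
open import Data.Bool.Properties using (∧-comm; ∧-zeroʳ)
open import Data.Empty using (⊥-elim)
open import Data.Fin using (Fin)
open import Data.Fin.Properties using (all?; any?)
open import Data.Fin.Subset
open import Data.Fin.Subset.Properties
open import Data.Nat as ℕ using (ℕ; zero; suc; _+_; _≤_; _<_; s≤s; z≤n; z<s)
open import Data.Nat.Induction using (<-rec)
open import Data.Nat.Properties
  using ( ≤-refl; ≤-reflexive; ≤-trans; ≤-antisym; ≤-pred; <⇒≢; >⇒≢; <⇒≱; ≰⇒>
        ; +-suc; +-comm; +-mono-≤; +-cancelˡ-≤; +-cancelʳ-≤; +-cancelʳ-≡; m<m+n; suc-injective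
        ; module ≤-Reasoning )
open import Data.Product using (_×_; _,_; ∃; proj₁; proj₂)
open import Data.Sum using (_⊎_; inj₁; inj₂; [_,_]′) renaming (map to map-⊎; swap to swap-⊎)
open import Data.Vec using ([]; _∷_; here; there)
open import Function using (_∘_; case_of_)
open import Relation.Binary.PropositionalEquality
open import Relation.Nullary using (¬_; Dec; yes; no; does; contradiction; ¬?)
open import Relation.Nullary.Decidable using (dec-true; _×-dec_; _→-dec_)

private
  variable
    n : ℕ
    p q r : Subset n

∧-true⁻ : ∀ {x y} → x ∧ y ≡ true → x ≡ true × y ≡ true
∧-true⁻ {true} y≡true = refl , y≡true

∧-true⁺ : ∀ {x y} → x ≡ true → y ≡ true → x ∧ y ≡ true
∧-true⁺ refl refl = refl

∨-true⁻ : ∀ {x y} → x ∨ y ≡ true → x ≡ true ⊎ y ≡ true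
∨-true⁻ {true}  _      = inj₁ refl
∨-true⁻ {false} y≡true = inj₂ y≡true

∨-true⁺ : ∀ {x y} → x ≡ true ⊎ y ≡ true → x ∨ y ≡ true
∨-true⁺ (inj₁ refl)         = refl
∨-true⁺ {true}  (inj₂ _)    = refl
∨-true⁺ {false} (inj₂ refl) = refl

does≡true⇒ : ∀ {P : Set} (P? : Dec P) → does P? ≡ true → P
does≡true⇒ (yes p) _ = p

Disjoint : Subset n → Subset n → Set
Disjoint p q = ∀ {x} → x ∈ p → x ∉ q

∪⊆ : q ⊆ p → r ⊆ p → q ∪ r ⊆ p
∪⊆ {q = q} {r = r} q⊆p r⊆p x∈q∪r = [ q⊆p , r⊆p ]′ (x∈p∪q⁻ q r x∈q∪r)

endpoint : ∀ {a b x : Fin n} → x ∈ ⁅ a ⁆ ∪ ⁅ b ⁆ → x ≡ a ⊎ x ≡ b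
endpoint {a = a} {b} = map-⊎ (x∈⁅y⁆⇒x≡y a) (x∈⁅y⁆⇒x≡y b) ∘ x∈p∪q⁻ ⁅ a ⁆ ⁅ b ⁆

x∈p⇒⁅x⁆⊆p : ∀ {x} → x ∈ p → ⁅ x ⁆ ⊆ p
x∈p⇒⁅x⁆⊆p {p = p} {x} x∈p y∈⁅x⁆ = subst (_∈ p) (sym (x∈⁅y⁆⇒x≡y x y∈⁅x⁆)) x∈p

x∉p⇒p⊆p-x : ∀ {x} → x ∉ p → p ⊆ p ∩ ∁ ⁅ x ⁆
x∉p⇒p⊆p-x {x = x} x∉p {y} y∈p =
  x∈p∩q⁺ (y∈p , x∉p⇒x∈∁p λ y∈⁅x⁆ → x∉p (subst (_∈ _) (x∈⁅y⁆⇒x≡y x y∈⁅x⁆) y∈p))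

x∈p⇒0<∣p∣ : ∀ {x} → x ∈ p → 0 < ∣ p ∣
x∈p⇒0<∣p∣ {x = x} x∈p = subst (_≤ _) (∣⁅x⁆∣≡1 x) (p⊆q⇒∣p∣≤∣q∣ (x∈p⇒⁅x⁆⊆p x∈p))

0<∣p∣⇒Nonempty : 0 < ∣ p ∣ → Nonempty p
0<∣p∣⇒Nonempty {n} {p} 0<∣p∣ with nonempty? p
... | yes p≢∅ = p≢∅
... | no  p≡∅ = contradiction (trans (cong ∣_∣ (Empty-unique p≡∅)) (∣⊥∣≡0 n)) (>⇒≢ 0<∣p∣)

p-q∪q≡p : q ⊆ p → p ∩ ∁ q ∪ q ≡ p
p-q∪q≡p {q = q} {p = p} q⊆p = ⊆-antisym (∪⊆ (p∩q⊆p p (∁ q)) q⊆p) p⊆p-q∪q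
  where
  p⊆p-q∪q : p ⊆ p ∩ ∁ q ∪ q
  p⊆p-q∪q {x} x∈p with x ∈? q
  ... | yes x∈q = x∈p∪q⁺ (inj₂ x∈q)
  ... | no  x∉q = x∈p∪q⁺ (inj₁ (x∈p∩q⁺ (x∈p , x∉p⇒x∈∁p x∉q)))

p-q∩q≡∅ : Disjoint (p ∩ ∁ q) q
p-q∩q≡∅ {p = p} {q} = x∈∁p⇒x∉p ∘ proj₂ ∘ x∈p∩q⁻ p (∁ q)

∣p∪q∣≡∣p∣+∣q∣ : Disjoint p q → ∣ p ∪ q ∣ ≡ ∣ p ∣ + ∣ q ∣
∣p∪q∣≡∣p∣+∣q∣ {p = []}          {[]}          _     = refl
∣p∪q∣≡∣p∣+∣q∣ {p = inside  ∷ p} {inside  ∷ q} p∩q≡∅ = contradiction here (p∩q≡∅ here)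
∣p∪q∣≡∣p∣+∣q∣ {p = inside  ∷ p} {outside ∷ q} p∩q≡∅ =
  cong suc (∣p∪q∣≡∣p∣+∣q∣ (λ x∈p x∈q → p∩q≡∅ (there x∈p) (there x∈q)))
∣p∪q∣≡∣p∣+∣q∣ {p = outside ∷ p} {inside  ∷ q} p∩q≡∅ =
  trans (cong suc (∣p∪q∣≡∣p∣+∣q∣ (λ x∈p x∈q → p∩q≡∅ (there x∈p) (there x∈q)))) (sym (+-suc ∣ p ∣ ∣ q ∣))
∣p∪q∣≡∣p∣+∣q∣ {p = outside ∷ p} {outside ∷ q} p∩q≡∅ =
  ∣p∪q∣≡∣p∣+∣q∣ (λ x∈p x∈q → p∩q≡∅ (there x∈p) (there x∈q))

∣p∣≡∣q∣+∣r∣ : Disjoint q r → p ⊆ q ∪ r → q ⊆ p → r ⊆ p → ∣ p ∣ ≡ ∣ q ∣ + ∣ r ∣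
∣p∣≡∣q∣+∣r∣ q∩r≡∅ p⊆q∪r q⊆p r⊆p =
  trans (cong ∣_∣ (⊆-antisym p⊆q∪r (∪⊆ q⊆p r⊆p))) (∣p∪q∣≡∣p∣+∣q∣ q∩r≡∅)

∣p∣≡∣p∩q∣+∣p∩r∣ : (∀ x → x ∈ q ⊎ x ∈ r) → Disjoint q r → ∀ p → ∣ p ∣ ≡ ∣ p ∩ q ∣ + ∣ p ∩ r ∣
∣p∣≡∣p∩q∣+∣p∩r∣ {q = q} {r} q∪r≡⊤ q∩r≡∅ p = ∣p∣≡∣q∣+∣r∣ disjoint split (p∩q⊆p p q) (p∩q⊆p p r)
  where
  disjoint : Disjoint (p ∩ q) (p ∩ r)
  disjoint x∈p∩q x∈p∩r = q∩r≡∅ (proj₂ (x∈p∩q⁻ p q x∈p∩q)) (proj₂ (x∈p∩q⁻ p r x∈p∩r))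
  split : p ⊆ p ∩ q ∪ p ∩ r
  split {x} x∈p = x∈p∪q⁺ (map-⊎ (λ x∈q → x∈p∩q⁺ (x∈p , x∈q)) (λ x∈r → x∈p∩q⁺ (x∈p , x∈r)) (q∪r≡⊤ x))

x∈p⇒∣p∣≡1+∣p-x∣ : ∀ {x} → x ∈ p → ∣ p ∣ ≡ suc ∣ p ∩ ∁ ⁅ x ⁆ ∣
x∈p⇒∣p∣≡1+∣p-x∣ {p = p} {x} x∈p = begin
  ∣ p ∣                       ≡⟨ cong ∣_∣ (p-q∪q≡p (x∈p⇒⁅x⁆⊆p x∈p)) ⟨
  ∣ p ∩ ∁ ⁅ x ⁆ ∪ ⁅ x ⁆ ∣       ≡⟨ ∣p∪q∣≡∣p∣+∣q∣ (p-q∩q≡∅ {p = p}) ⟩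
  ∣ p ∩ ∁ ⁅ x ⁆ ∣ + ∣ ⁅ x ⁆ ∣   ≡⟨ cong (∣ p ∩ ∁ ⁅ x ⁆ ∣ +_) (∣⁅x⁆∣≡1 x) ⟩
  ∣ p ∩ ∁ ⁅ x ⁆ ∣ + 1          ≡⟨ +-comm _ 1 ⟩
  suc ∣ p ∩ ∁ ⁅ x ⁆ ∣          ∎
  where open ≡-Reasoning

∣p∩q∣≡1+∣p-r∩q∣ : ∀ {x} → x ∈ p ∩ q → x ∈ r → (∀ {y} → y ∈ r → y ∈ q → y ≡ x)
  → ∣ p ∩ q ∣ ≡ suc ∣ (p ∩ ∁ r) ∩ q ∣
∣p∩q∣≡1+∣p-r∩q∣ {p = p} {q} {r} {x} x∈p∩q x∈r r∩q⊆⁅x⁆ =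
  trans (∣p∣≡∣q∣+∣r∣ disjoint split (x∈p⇒⁅x⁆⊆p x∈p∩q) p-r∩q⊆p∩q)
        (cong (_+ ∣ (p ∩ ∁ r) ∩ q ∣) (∣⁅x⁆∣≡1 x))
  where
  disjoint : Disjoint ⁅ x ⁆ ((p ∩ ∁ r) ∩ q)
  disjoint y∈⁅x⁆ y∈p-r∩q = x∈∁p⇒x∉p (proj₂ (x∈p∩q⁻ p (∁ r) (proj₁ (x∈p∩q⁻ (p ∩ ∁ r) q y∈p-r∩q))))
    (subst (_∈ r) (sym (x∈⁅y⁆⇒x≡y x y∈⁅x⁆)) x∈r)
  split : p ∩ q ⊆ ⁅ x ⁆ ∪ (p ∩ ∁ r) ∩ q
  split {y} y∈p∩q with x∈p∩q⁻ p q y∈p∩q | y ∈? r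
  ... | _     , y∈q | yes y∈r = x∈p∪q⁺ (inj₁ (subst (_∈ ⁅ x ⁆) (sym (r∩q⊆⁅x⁆ y∈r y∈q)) (x∈⁅x⁆ x)))
  ... | y∈p , y∈q   | no  y∉r = x∈p∪q⁺ (inj₂ (x∈p∩q⁺ (x∈p∩q⁺ (y∈p , x∉p⇒x∈∁p y∉r) , y∈q)))
  p-r∩q⊆p∩q : (p ∩ ∁ r) ∩ q ⊆ p ∩ q
  p-r∩q⊆p∩q y∈p-r∩q with x∈p∩q⁻ (p ∩ ∁ r) q y∈p-r∩q
  ... | y∈p-r , y∈q = x∈p∩q⁺ (proj₁ (x∈p∩q⁻ p (∁ r) y∈p-r) , y∈q)

bothIn : Subset n → Fin n → Fin n → Bool
bothIn e u v = does (u ∈? e) ∧ does (v ∈? e)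

α[_∣_]≤_ : Graph n → Subset n → ℕ → Set
α[ G ∣ W ]≤ k = ∀ U → Stable G U → U ⊆ W → ∣ U ∣ ≤ k

module _ (G : Graph n) where

  stable? : (S : Subset n) → Dec (Stable G S)
  stable? S = all? λ u → all? λ v →
    (u ∈? S) →-dec ((v ∈? S) →-dec ¬? (adj G u v Bool.≟ true))

  Stable-⊆ : q ⊆ p → Stable G p → Stable G q
  Stable-⊆ q⊆p p-stable u v u∈q v∈q = p-stable u v (q⊆p u∈q) (q⊆p v∈q)

  Stable-∪ : Stable G p → Stable G q
    → (∀ x y → x ∈ p → y ∈ q → ¬ adj G x y ≡ true) → Stable G (p ∪ q)
  Stable-∪ {p = p} {q} p-stable q-stable p≁q x y x∈p∪q y∈p∪q
    with x∈p∪q⁻ p q x∈p∪q | x∈p∪q⁻ p q y∈p∪q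
  ... | inj₁ x∈p | inj₁ y∈p = p-stable x y x∈p y∈p
  ... | inj₂ x∈q | inj₂ y∈q = q-stable x y x∈q y∈q
  ... | inj₁ x∈p | inj₂ y∈q = p≁q x y x∈p y∈q
  ... | inj₂ x∈q | inj₁ y∈p = p≁q y x y∈p x∈q ∘ Graph.sym G x y

  ⁅x⁆-stable : ∀ x → Stable G ⁅ x ⁆
  ⁅x⁆-stable x u v u∈⁅x⁆ v∈⁅x⁆ uv
    rewrite x∈⁅y⁆⇒x≡y x u∈⁅x⁆ | x∈⁅y⁆⇒x≡y x v∈⁅x⁆ = irrefl G x uv

  bipartition-swap : ∀ {A B} → IsBipartition G A B → IsBipartition G B A
  bipartition-swap (cover , disjoint , A-stable , B-stable) =
    swap-⊎ ∘ cover , (λ v v∈B v∈A → disjoint v v∈A v∈B) , B-stable , A-stable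

  record IsPerfectMatchingOn (W : Subset n) (M : Fin n → Fin n → Bool) : Set where
    field
      symmetric : ∀ u v → M u v ≡ true → M v u ≡ true
      edges     : ∀ u v → M u v ≡ true → adj G u v ≡ true
      within    : ∀ u v → M u v ≡ true → u ∈ W
      partner   : ∀ v → v ∈ W → ∃ λ u → M v u ≡ true × (∀ w → M v w ≡ true → w ≡ u)

  open IsPerfectMatchingOn

  emptyMatching : ∀ {W} → Empty W → IsPerfectMatchingOn W (λ _ _ → false)
  emptyMatching W≡∅ = record
    { symmetric = λ _ _ ()
    ; edges     = λ _ _ ()
    ; within    = λ _ _ ()
    ; partner   = λ v v∈W → ⊥-elim (W≡∅ (v , v∈W))
    }

  ∪-matching : ∀ {W₁ W₂ M₁ M₂} → Disjoint W₁ W₂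
    → IsPerfectMatchingOn W₁ M₁ → IsPerfectMatchingOn W₂ M₂
    → IsPerfectMatchingOn (W₁ ∪ W₂) (λ u v → M₁ u v ∨ M₂ u v)
  ∪-matching {W₁} {W₂} {M₁} {M₂} W₁∩W₂≡∅ P₁ P₂ = record
    { symmetric = λ u v → ∨-true⁺ ∘ map-⊎ (symmetric P₁ u v) (symmetric P₂ u v) ∘ ∨-true⁻
    ; edges     = λ u v → [ edges P₁ u v , edges P₂ u v ]′ ∘ ∨-true⁻
    ; within    = λ u v → x∈p∪q⁺ ∘ map-⊎ (within P₁ u v) (within P₂ u v) ∘ ∨-true⁻
    ; partner   = λ v v∈W₁∪W₂ → [ partner₁ v , partner₂ v ]′ (x∈p∪q⁻ W₁ W₂ v∈W₁∪W₂)
    }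
    where
    M : Fin n → Fin n → Bool
    M u v = M₁ u v ∨ M₂ u v
    partner₁ : ∀ v → v ∈ W₁ → ∃ λ u → M v u ≡ true × (∀ w → M v w ≡ true → w ≡ u)
    partner₁ v v∈W₁ with partner P₁ v v∈W₁
    ... | u , vu , unique = u , ∨-true⁺ (inj₁ vu) ,
      λ w → [ unique w , (λ vw → contradiction (within P₂ v w vw) (W₁∩W₂≡∅ v∈W₁)) ]′ ∘ ∨-true⁻
    partner₂ : ∀ v → v ∈ W₂ → ∃ λ u → M v u ≡ true × (∀ w → M v w ≡ true → w ≡ u)
    partner₂ v v∈W₂ with partner P₂ v v∈W₂
    ... | u , vu , unique = u , ∨-true⁺ (inj₂ vu) ,
      λ w → [ (λ vw → contradiction v∈W₂ (W₁∩W₂≡∅ (within P₁ v w vw))) , unique w ]′ ∘ ∨-true⁻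

  edgeMatching : ∀ {a b} → adj G a b ≡ true
    → IsPerfectMatchingOn (⁅ a ⁆ ∪ ⁅ b ⁆) (λ u v → adj G u v ∧ bothIn (⁅ a ⁆ ∪ ⁅ b ⁆) u v)
  edgeMatching {a} {b} ab = record
    { symmetric = λ u v uv → let (uv , u∈e , v∈e) = unmatched uv in matched (Graph.sym G u v uv) v∈e u∈e
    ; edges     = λ u v uv → proj₁ (unmatched uv)
    ; within    = λ u v uv → proj₁ (proj₂ (unmatched uv))
    ; partner   = partnerInE
    }
    where
    e : Subset n
    e = ⁅ a ⁆ ∪ ⁅ b ⁆
    a∈e : a ∈ e
    a∈e = x∈p∪q⁺ (inj₁ (x∈⁅x⁆ a))
    b∈e : b ∈ e
    b∈e = x∈p∪q⁺ (inj₂ (x∈⁅x⁆ b))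
    matched : ∀ {u v} → adj G u v ≡ true → u ∈ e → v ∈ e → adj G u v ∧ bothIn e u v ≡ true
    matched {u} {v} uv u∈e v∈e = ∧-true⁺ uv (∧-true⁺ (dec-true (u ∈? e) u∈e) (dec-true (v ∈? e) v∈e))
    unmatched : ∀ {u v} → adj G u v ∧ bothIn e u v ≡ true → adj G u v ≡ true × u ∈ e × v ∈ e
    unmatched {u} {v} uv∈M with ∧-true⁻ uv∈M
    ... | uv , both with ∧-true⁻ both
    ...   | u∈e , v∈e = uv , does≡true⇒ (u ∈? e) u∈e , does≡true⇒ (v ∈? e) v∈e
    partnerInE : ∀ v → v ∈ e
      → ∃ λ u → adj G v u ∧ bothIn e v u ≡ true × (∀ w → adj G v w ∧ bothIn e v w ≡ true → w ≡ u)
    partnerInE v v∈e with endpoint v∈e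
    ... | inj₁ refl = b , matched ab a∈e b∈e , λ w aw → onlyB w (unmatched aw)
      where
      onlyB : ∀ w → adj G a w ≡ true × a ∈ e × w ∈ e → w ≡ b
      onlyB w (aw , _ , w∈e) with endpoint w∈e
      ... | inj₁ refl = contradiction aw (irrefl G a)
      ... | inj₂ w≡b  = w≡b
    ... | inj₂ refl = a , matched (Graph.sym G a b ab) b∈e a∈e , λ w bw → onlyA w (unmatched bw)
      where
      onlyA : ∀ w → adj G b w ≡ true × b ∈ e × w ∈ e → w ≡ a
      onlyA w (bw , _ , w∈e) with endpoint w∈e
      ... | inj₁ w≡a  = w≡a
      ... | inj₂ refl = contradiction bw (irrefl G b)

-- Deletes every edge with both ends in e; for e = ⁅ u ⁆ ∪ ⁅ v ⁆ this is G minus the edge uv.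
_∖_ : Graph n → Subset n → Graph n
G ∖ e = record
  { adj    = λ u v → adj G u v ∧ not (bothIn e u v)
  ; sym    = λ u v uv∈G∖e → let (uv , ¬both) = ∧-true⁻ uv∈G∖e in
      ∧-true⁺ (Graph.sym G u v uv) (subst (λ b → not b ≡ true) (∧-comm (does (u ∈? e)) _) ¬both)
  ; irrefl = λ v vv → irrefl G v (proj₁ (∧-true⁻ vv))
  }

module _ (G : Graph n) {e : Subset n} where

  ∖-adj⁻ : ∀ {u v} → adj (G ∖ e) u v ≡ true → adj G u v ≡ true
  ∖-adj⁻ = proj₁ ∘ ∧-true⁻

  ∖-adj⁺ : ∀ {u v} → adj G u v ≡ true → ¬ (u ∈ e × v ∈ e) → adj (G ∖ e) u v ≡ true
  ∖-adj⁺ {u} {v} uv ¬both with u ∈? e | v ∈? e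
  ... | yes u∈e | yes v∈e = contradiction (u∈e , v∈e) ¬both
  ... | yes _   | no  _   rewrite uv = refl
  ... | no  _   | yes _   rewrite uv = refl
  ... | no  _   | no  _   rewrite uv = refl

  ∖-nonadj : ∀ {u v} → u ∈ e → v ∈ e → ¬ adj (G ∖ e) u v ≡ true
  ∖-nonadj {u} {v} u∈e v∈e uv
    rewrite dec-true (u ∈? e) u∈e | dec-true (v ∈? e) v∈e | ∧-zeroʳ (adj G u v) = case uv of λ ()

  Stable-∖ : ∀ {S} → Stable G S → Stable (G ∖ e) S
  Stable-∖ S-stable u v u∈S v∈S = S-stable u v u∈S v∈S ∘ ∖-adj⁻

  ∖-Stable : ∀ {T} → Stable (G ∖ e) T → (∀ {x y} → x ∈ T → y ∈ T → x ∈ e → y ∈ e → x ≡ y)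
    → Stable G T
  ∖-Stable T-stable atMostOne x y x∈T y∈T xy = T-stable x y x∈T y∈T (∖-adj⁺ xy λ (x∈e , y∈e) →
    irrefl G y (subst (λ z → adj G z y ≡ true) (atMostOne x∈T y∈T x∈e y∈e) xy))

  ∖-bipartition : ∀ {A B} → IsBipartition G A B → IsBipartition (G ∖ e) A B
  ∖-bipartition (cover , disjoint , A-stable , B-stable) =
    cover , disjoint , Stable-∖ A-stable , Stable-∖ B-stable

  ∖-perfectMatching : ∀ {M} → PerfectMatching (G ∖ e) M → PerfectMatching G M
  ∖-perfectMatching (symmetric , edges , partner) = symmetric , (λ u v → ∖-adj⁻ ∘ edges u v) , partner

-- A stable T ⊆ W of size k splits W into W₁ = (T ∩ S) ∪ (W ∩ S' − T) and its mirror image: a stable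
-- U ⊆ W₁ together with T ∩ S' is still stable in W, so α(W₁) ≤ k − ∣ T ∩ S' ∣ = ∣ T ∩ S ∣.
module Split (G : Graph n) {S S' W T : Subset n} {k : ℕ} (bip : IsBipartition G S S')
  (T-stable : Stable G T) (T⊆W : T ⊆ W) (∣T∣≡k : ∣ T ∣ ≡ k) (∣W∩S'∣≡k : ∣ W ∩ S' ∣ ≡ k)
  (α≤k : α[ G ∣ W ]≤ k) where

  private
    cover : ∀ x → x ∈ S ⊎ x ∈ S'
    cover = proj₁ bip
    S∩S'≡∅ : Disjoint S S'
    S∩S'≡∅ {x} = proj₁ (proj₂ bip) x
    S'-stable : Stable G S'
    S'-stable = proj₂ (proj₂ (proj₂ bip))

  W₁ : Subset n
  W₁ = T ∩ S ∪ (W ∩ S') ∩ ∁ T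

  ∈W₁⁻ : ∀ {x} → x ∈ W₁ → (x ∈ T × x ∈ S) ⊎ (x ∈ W × x ∈ S' × x ∉ T)
  ∈W₁⁻ x∈W₁ with x∈p∪q⁻ (T ∩ S) ((W ∩ S') ∩ ∁ T) x∈W₁
  ... | inj₁ x∈T∩S = inj₁ (x∈p∩q⁻ T S x∈T∩S)
  ... | inj₂ x∈W∩S'-T with x∈p∩q⁻ (W ∩ S') (∁ T) x∈W∩S'-T
  ...   | x∈W∩S' , x∈∁T = inj₂ (proj₁ (x∈p∩q⁻ W S' x∈W∩S') , proj₂ (x∈p∩q⁻ W S' x∈W∩S') , x∈∁p⇒x∉p x∈∁T)

  W₁⊆W : W₁ ⊆ W
  W₁⊆W = [ T⊆W ∘ proj₁ , proj₁ ]′ ∘ ∈W₁⁻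

  ∣W₁∩S∣≡∣T∩S∣ : ∣ W₁ ∩ S ∣ ≡ ∣ T ∩ S ∣
  ∣W₁∩S∣≡∣T∩S∣ = cong ∣_∣ (⊆-antisym W₁∩S⊆T∩S λ x∈T∩S →
    x∈p∩q⁺ (x∈p∪q⁺ (inj₁ x∈T∩S) , proj₂ (x∈p∩q⁻ T S x∈T∩S)))
    where
    W₁∩S⊆T∩S : W₁ ∩ S ⊆ T ∩ S
    W₁∩S⊆T∩S x∈W₁∩S with x∈p∩q⁻ W₁ S x∈W₁∩S
    ... | x∈W₁ , x∈S with ∈W₁⁻ x∈W₁
    ...   | inj₁ x∈T∩S = x∈p∩q⁺ x∈T∩S
    ...   | inj₂ (_ , x∈S' , _) = contradiction x∈S' (S∩S'≡∅ x∈S)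

  ∣W₁∩S'∣≡∣T∩S∣ : ∣ W₁ ∩ S' ∣ ≡ ∣ T ∩ S ∣
  ∣W₁∩S'∣≡∣T∩S∣ = +-cancelʳ-≡ ∣ T ∩ S' ∣ _ _ (begin
    ∣ W₁ ∩ S' ∣ + ∣ T ∩ S' ∣        ≡⟨ cong (_+ ∣ T ∩ S' ∣) ∣W₁∩S'∣≡∣W∩S'-T∣ ⟩
    ∣ (W ∩ S') ∩ ∁ T ∣ + ∣ T ∩ S' ∣ ≡⟨ +-comm _ ∣ T ∩ S' ∣ ⟩
    ∣ T ∩ S' ∣ + ∣ (W ∩ S') ∩ ∁ T ∣ ≡⟨ sym ∣W∩S'∣≡∣T∩S'∣+∣W∩S'-T∣ ⟩
    ∣ W ∩ S' ∣                     ≡⟨ trans ∣W∩S'∣≡k (sym ∣T∣≡k) ⟩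
    ∣ T ∣                          ≡⟨ ∣p∣≡∣p∩q∣+∣p∩r∣ cover S∩S'≡∅ T ⟩
    ∣ T ∩ S ∣ + ∣ T ∩ S' ∣          ∎)
    where
    open ≡-Reasoning
    ∣W₁∩S'∣≡∣W∩S'-T∣ : ∣ W₁ ∩ S' ∣ ≡ ∣ (W ∩ S') ∩ ∁ T ∣
    ∣W₁∩S'∣≡∣W∩S'-T∣ = cong ∣_∣ (⊆-antisym W₁∩S'⊆W∩S'-T λ x∈W∩S'-T → x∈p∩q⁺
      (x∈p∪q⁺ (inj₂ x∈W∩S'-T) , proj₂ (x∈p∩q⁻ W S' (proj₁ (x∈p∩q⁻ (W ∩ S') (∁ T) x∈W∩S'-T)))))
      where
      W₁∩S'⊆W∩S'-T : W₁ ∩ S' ⊆ (W ∩ S') ∩ ∁ T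
      W₁∩S'⊆W∩S'-T x∈W₁∩S' with x∈p∩q⁻ W₁ S' x∈W₁∩S'
      ... | x∈W₁ , x∈S' with ∈W₁⁻ x∈W₁
      ...   | inj₁ (_ , x∈S) = contradiction x∈S' (S∩S'≡∅ x∈S)
      ...   | inj₂ (x∈W , _ , x∉T) = x∈p∩q⁺ (x∈p∩q⁺ (x∈W , x∈S') , x∉p⇒x∈∁p x∉T)
    ∣W∩S'∣≡∣T∩S'∣+∣W∩S'-T∣ : ∣ W ∩ S' ∣ ≡ ∣ T ∩ S' ∣ + ∣ (W ∩ S') ∩ ∁ T ∣
    ∣W∩S'∣≡∣T∩S'∣+∣W∩S'-T∣ =
      ∣p∣≡∣q∣+∣r∣ disjoint split T∩S'⊆W∩S' (p∩q⊆p (W ∩ S') (∁ T))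
      where
      disjoint : Disjoint (T ∩ S') ((W ∩ S') ∩ ∁ T)
      disjoint x∈T∩S' x∈W∩S'-T =
        x∈∁p⇒x∉p (proj₂ (x∈p∩q⁻ (W ∩ S') (∁ T) x∈W∩S'-T)) (proj₁ (x∈p∩q⁻ T S' x∈T∩S'))
      split : W ∩ S' ⊆ T ∩ S' ∪ (W ∩ S') ∩ ∁ T
      split {x} x∈W∩S' with x ∈? T
      ... | yes x∈T = x∈p∪q⁺ (inj₁ (x∈p∩q⁺ (x∈T , proj₂ (x∈p∩q⁻ W S' x∈W∩S'))))
      ... | no  x∉T = x∈p∪q⁺ (inj₂ (x∈p∩q⁺ (x∈W∩S' , x∉p⇒x∈∁p x∉T)))
      T∩S'⊆W∩S' : T ∩ S' ⊆ W ∩ S'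
      T∩S'⊆W∩S' x∈T∩S' with x∈p∩q⁻ T S' x∈T∩S'
      ... | x∈T , x∈S' = x∈p∩q⁺ (T⊆W x∈T , x∈S')

  α[W₁]≤∣T∩S∣ : α[ G ∣ W₁ ]≤ ∣ T ∩ S ∣
  α[W₁]≤∣T∩S∣ U U-stable U⊆W₁ = +-cancelʳ-≤ (∣ T ∩ S' ∣) (∣ U ∣) (∣ T ∩ S ∣) (begin
    ∣ U ∣ + ∣ T ∩ S' ∣      ≡⟨ ∣p∪q∣≡∣p∣+∣q∣ disjoint ⟨
    ∣ U ∪ T ∩ S' ∣         ≤⟨ α≤k _ U∪T∩S'-stable (∪⊆ (W₁⊆W ∘ U⊆W₁) (T⊆W ∘ p∩q⊆p T S')) ⟩
    k                      ≡⟨ ∣T∣≡k ⟨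
    ∣ T ∣                  ≡⟨ ∣p∣≡∣p∩q∣+∣p∩r∣ cover S∩S'≡∅ T ⟩
    ∣ T ∩ S ∣ + ∣ T ∩ S' ∣ ∎)
    where
    open ≤-Reasoning
    disjoint : Disjoint U (T ∩ S')
    disjoint x∈U x∈T∩S' with ∈W₁⁻ (U⊆W₁ x∈U) | x∈p∩q⁻ T S' x∈T∩S'
    ... | inj₁ (_ , x∈S)     | _ , x∈S' = S∩S'≡∅ x∈S x∈S'
    ... | inj₂ (_ , _ , x∉T) | x∈T , _  = x∉T x∈T
    U∪T∩S'-stable : Stable G (U ∪ T ∩ S')
    U∪T∩S'-stable = Stable-∪ G U-stable (Stable-⊆ G (p∩q⊆p T S') T-stable) λ x y x∈U y∈T∩S' →
      case ∈W₁⁻ (U⊆W₁ x∈U) of λ where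
        (inj₁ (x∈T , _))      → T-stable x y x∈T (proj₁ (x∈p∩q⁻ T S' y∈T∩S'))
        (inj₂ (_ , x∈S' , _)) → S'-stable x y x∈S' (proj₂ (x∈p∩q⁻ T S' y∈T∩S'))

  ∣T∩S∣<k : Nonempty (W ∩ S ∩ ∁ T) → ∣ W ∩ S ∣ ≡ k → ∣ T ∩ S ∣ < k
  ∣T∩S∣<k (x , x∈W∩S-T) ∣W∩S∣≡k with x∈p∩q⁻ W (S ∩ ∁ T) x∈W∩S-T
  ... | x∈W , x∈S-T with x∈p∩q⁻ S (∁ T) x∈S-T
  ...   | x∈S , x∈∁T = subst (∣ T ∩ S ∣ <_) ∣W∩S∣≡k (p⊂q⇒∣p∣<∣q∣
    (T∩S⊆W∩S , x , x∈p∩q⁺ (x∈W , x∈S) , x∈∁p⇒x∉p x∈∁T ∘ proj₁ ∘ x∈p∩q⁻ T S))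
    where
    T∩S⊆W∩S : T ∩ S ⊆ W ∩ S
    T∩S⊆W∩S x∈T∩S = let (x∈T , x∈S) = x∈p∩q⁻ T S x∈T∩S in x∈p∩q⁺ (T⊆W x∈T , x∈S)

module König (G : Graph n) {A B : Subset n} (bip : IsBipartition G A B) where

  private
    cover : ∀ x → x ∈ A ⊎ x ∈ B
    cover = proj₁ bip
    A∩B≡∅ : Disjoint A B
    A∩B≡∅ {x} = proj₁ (proj₂ bip) x
    B-stable : Stable G B
    B-stable = proj₂ (proj₂ (proj₂ bip))

  Matchable : ℕ → Set
  Matchable k = ∀ W → ∣ W ∩ A ∣ ≡ k → ∣ W ∩ B ∣ ≡ k → α[ G ∣ W ]≤ k → ∃ (IsPerfectMatchingOn G W)

  SplittingSet : Subset n → ℕ → Subset n → Set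
  SplittingSet W k T =
    Stable G T × T ⊆ W × ∣ T ∣ ≡ k × Nonempty (W ∩ A ∩ ∁ T) × Nonempty (W ∩ B ∩ ∁ T)

  splittingSet? : ∀ W k T → Dec (SplittingSet W k T)
  splittingSet? W k T = stable? G T ×-dec T ⊆? W ×-dec ∣ T ∣ ℕ.≟ k
    ×-dec nonempty? (W ∩ A ∩ ∁ T) ×-dec nonempty? (W ∩ B ∩ ∁ T)

  matchable-zero : Matchable 0
  matchable-zero W ∣W∩A∣≡0 ∣W∩B∣≡0 _ = _ , emptyMatching G W-empty
    where
    W-empty : Empty W
    W-empty (x , x∈W) = [ (λ x∈A → <⇒≢ (x∈p⇒0<∣p∣ (x∈p∩q⁺ (x∈W , x∈A))) (sym ∣W∩A∣≡0))
                        , (λ x∈B → <⇒≢ (x∈p⇒0<∣p∣ (x∈p∩q⁺ (x∈W , x∈B))) (sym ∣W∩B∣≡0)) ]′ (cover x)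

  matchable-split : ∀ {k W T} → (∀ {j} → j < k → Matchable j)
    → ∣ W ∩ A ∣ ≡ k → ∣ W ∩ B ∣ ≡ k → α[ G ∣ W ]≤ k → SplittingSet W k T
    → ∃ (IsPerfectMatchingOn G W)
  matchable-split {W = W} {T} rec ∣W∩A∣≡k ∣W∩B∣≡k α≤k (T-stable , T⊆W , ∣T∣≡k , missesA , missesB) =
    subst (∃ ∘ IsPerfectMatchingOn G) (sym W≡W₁∪W₂)
      (_ , ∪-matching G W₁∩W₂≡∅ (proj₂ matching₁) (proj₂ matching₂))
    where
    module H₁ = Split G bip T-stable T⊆W ∣T∣≡k ∣W∩B∣≡k α≤k
    module H₂ = Split G (bipartition-swap G bip) T-stable T⊆W ∣T∣≡k ∣W∩A∣≡k α≤k
    matching₁ : ∃ (IsPerfectMatchingOn G H₁.W₁)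
    matching₁ = rec (H₁.∣T∩S∣<k missesA ∣W∩A∣≡k)
      H₁.W₁ H₁.∣W₁∩S∣≡∣T∩S∣ H₁.∣W₁∩S'∣≡∣T∩S∣ H₁.α[W₁]≤∣T∩S∣
    matching₂ : ∃ (IsPerfectMatchingOn G H₂.W₁)
    matching₂ = rec (H₂.∣T∩S∣<k missesB ∣W∩B∣≡k)
      H₂.W₁ H₂.∣W₁∩S'∣≡∣T∩S∣ H₂.∣W₁∩S∣≡∣T∩S∣ H₂.α[W₁]≤∣T∩S∣
    W₁∩W₂≡∅ : Disjoint H₁.W₁ H₂.W₁
    W₁∩W₂≡∅ x∈W₁ x∈W₂ with H₁.∈W₁⁻ x∈W₁ | H₂.∈W₁⁻ x∈W₂
    ... | inj₁ (_ , x∈A)     | inj₁ (_ , x∈B)     = A∩B≡∅ x∈A x∈B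
    ... | inj₁ (x∈T , _)     | inj₂ (_ , _ , x∉T) = x∉T x∈T
    ... | inj₂ (_ , _ , x∉T) | inj₁ (x∈T , _)     = x∉T x∈T
    ... | inj₂ (_ , x∈B , _) | inj₂ (_ , x∈A , _) = A∩B≡∅ x∈A x∈B
    W⊆W₁∪W₂ : W ⊆ H₁.W₁ ∪ H₂.W₁
    W⊆W₁∪W₂ {x} x∈W with x ∈? T | cover x
    ... | yes x∈T | inj₁ x∈A = x∈p∪q⁺ (inj₁ (x∈p∪q⁺ (inj₁ (x∈p∩q⁺ (x∈T , x∈A)))))
    ... | yes x∈T | inj₂ x∈B = x∈p∪q⁺ (inj₂ (x∈p∪q⁺ (inj₁ (x∈p∩q⁺ (x∈T , x∈B)))))
    ... | no  x∉T | inj₁ x∈A = x∈p∪q⁺ (inj₂ (x∈p∪q⁺ (inj₂ (x∈p∩q⁺ (x∈p∩q⁺ (x∈W , x∈A) , x∉p⇒x∈∁p x∉T)))))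
    ... | no  x∉T | inj₂ x∈B = x∈p∪q⁺ (inj₁ (x∈p∪q⁺ (inj₂ (x∈p∩q⁺ (x∈p∩q⁺ (x∈W , x∈B) , x∉p⇒x∈∁p x∉T)))))
    W≡W₁∪W₂ : W ≡ H₁.W₁ ∪ H₂.W₁
    W≡W₁∪W₂ = ⊆-antisym W⊆W₁∪W₂ (∪⊆ H₁.W₁⊆W H₂.W₁⊆W)

  neighbour : ∀ {W a k} → a ∈ W ∩ A → ∣ W ∩ B ∣ ≡ k → α[ G ∣ W ]≤ k
    → ∃ λ b → b ∈ W ∩ B × adj G a b ≡ true
  neighbour {W} {a} {k} a∈W∩A ∣W∩B∣≡k α≤k
    with any? (λ b → (b ∈? W ∩ B) ×-dec (adj G a b Bool.≟ true))
  ... | yes found = found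
  ... | no  none  = contradiction (α≤k (W ∩ B ∪ ⁅ a ⁆) stable W∩B+a⊆W) (<⇒≱ k<∣W∩B+a∣)
    where
    a∉W∩B : a ∉ W ∩ B
    a∉W∩B a∈W∩B = A∩B≡∅ (proj₂ (x∈p∩q⁻ W A a∈W∩A)) (proj₂ (x∈p∩q⁻ W B a∈W∩B))
    k<∣W∩B+a∣ : k < ∣ W ∩ B ∪ ⁅ a ⁆ ∣
    k<∣W∩B+a∣ = begin-strict
      k                        <⟨ m<m+n k z<s ⟩
      k + 1                    ≡⟨ cong₂ _+_ ∣W∩B∣≡k (∣⁅x⁆∣≡1 a) ⟨
      ∣ W ∩ B ∣ + ∣ ⁅ a ⁆ ∣     ≡⟨ ∣p∪q∣≡∣p∣+∣q∣ {p = W ∩ B} a∉W∩B' ⟨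
      ∣ W ∩ B ∪ ⁅ a ⁆ ∣         ∎
      where
      open ≤-Reasoning
      a∉W∩B' : Disjoint (W ∩ B) ⁅ a ⁆
      a∉W∩B' x∈W∩B x∈⁅a⁆ = a∉W∩B (subst (_∈ W ∩ B) (x∈⁅y⁆⇒x≡y a x∈⁅a⁆) x∈W∩B)
    stable : Stable G (W ∩ B ∪ ⁅ a ⁆)
    stable = Stable-∪ G (Stable-⊆ G (p∩q⊆q W B) B-stable) (⁅x⁆-stable G a) λ x y x∈W∩B y∈⁅a⁆ xy →
      none (x , x∈W∩B , Graph.sym G x a (subst (λ z → adj G x z ≡ true) (x∈⁅y⁆⇒x≡y a y∈⁅a⁆) xy))
    W∩B+a⊆W : W ∩ B ∪ ⁅ a ⁆ ⊆ W
    W∩B+a⊆W = ∪⊆ (p∩q⊆p W B) (x∈p⇒⁅x⁆⊆p (proj₁ (x∈p∩q⁻ W A a∈W∩A)))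

  α[W-e]≤k : ∀ {k W e a b} → α[ G ∣ W ]≤ suc k → ¬ ∃ (SplittingSet W (suc k))
    → a ∈ W ∩ A → a ∈ e → b ∈ W ∩ B → b ∈ e → α[ G ∣ W ∩ ∁ e ]≤ k
  α[W-e]≤k {k} {W} {e} {a} {b} α≤1+k unsplit a∈W∩A a∈e b∈W∩B b∈e U U-stable U⊆W-e with ∣ U ∣ ℕ.≤? k
  ... | yes ∣U∣≤k = ∣U∣≤k
  ... | no  ∣U∣≰k = contradiction
    (U , U-stable , (λ {_} → U⊆W) , ∣U∣≡1+k , (a , missed a∈W∩A a∈e) , (b , missed b∈W∩B b∈e)) unsplit
    where
    U⊆W : U ⊆ W
    U⊆W = p∩q⊆p W (∁ e) ∘ U⊆W-e
    ∣U∣≡1+k : ∣ U ∣ ≡ suc k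
    ∣U∣≡1+k = ≤-antisym (α≤1+k U U-stable U⊆W) (≰⇒> ∣U∣≰k)
    missed : ∀ {x S} → x ∈ W ∩ S → x ∈ e → x ∈ W ∩ S ∩ ∁ U
    missed {x} {S} x∈W∩S x∈e = let (x∈W , x∈S) = x∈p∩q⁻ W S x∈W∩S in
      x∈p∩q⁺ (x∈W , x∈p∩q⁺ (x∈S , x∉p⇒x∈∁p λ x∈U → p-q∩q≡∅ {p = W} (U⊆W-e x∈U) x∈e))

  matchable-unsplit : ∀ {k W} → Matchable k
    → ∣ W ∩ A ∣ ≡ suc k → ∣ W ∩ B ∣ ≡ suc k → α[ G ∣ W ]≤ suc k
    → ¬ ∃ (SplittingSet W (suc k)) → ∃ (IsPerfectMatchingOn G W)
  matchable-unsplit {k} {W} matchable-k ∣W∩A∣≡1+k ∣W∩B∣≡1+k α≤1+k unsplit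
    with 0<∣p∣⇒Nonempty (subst (0 <_) (sym ∣W∩A∣≡1+k) z<s)
  ... | a , a∈W∩A with neighbour a∈W∩A ∣W∩B∣≡1+k α≤1+k
  ... | b , b∈W∩B , ab = subst (∃ ∘ IsPerfectMatchingOn G) (p-q∪q≡p e⊆W)
    (_ , ∪-matching G (p-q∩q≡∅ {p = W}) (proj₂ matchingW-e) (edgeMatching G ab))
    where
    e : Subset n
    e = ⁅ a ⁆ ∪ ⁅ b ⁆
    a∈e : a ∈ e
    a∈e = x∈p∪q⁺ (inj₁ (x∈⁅x⁆ a))
    b∈e : b ∈ e
    b∈e = x∈p∪q⁺ (inj₂ (x∈⁅x⁆ b))
    e⊆W : e ⊆ W
    e⊆W = ∪⊆ (x∈p⇒⁅x⁆⊆p (proj₁ (x∈p∩q⁻ W A a∈W∩A))) (x∈p⇒⁅x⁆⊆p (proj₁ (x∈p∩q⁻ W B b∈W∩B)))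
    e∩A⊆⁅a⁆ : ∀ {y} → y ∈ e → y ∈ A → y ≡ a
    e∩A⊆⁅a⁆ y∈e y∈A with endpoint y∈e
    ... | inj₁ y≡a  = y≡a
    ... | inj₂ refl = contradiction (proj₂ (x∈p∩q⁻ W B b∈W∩B)) (A∩B≡∅ y∈A)
    e∩B⊆⁅b⁆ : ∀ {y} → y ∈ e → y ∈ B → y ≡ b
    e∩B⊆⁅b⁆ y∈e y∈B with endpoint y∈e
    ... | inj₁ refl = contradiction y∈B (A∩B≡∅ (proj₂ (x∈p∩q⁻ W A a∈W∩A)))
    ... | inj₂ y≡b  = y≡b
    matchingW-e : ∃ (IsPerfectMatchingOn G (W ∩ ∁ e))
    matchingW-e = matchable-k (W ∩ ∁ e)
      (suc-injective (trans (sym (∣p∩q∣≡1+∣p-r∩q∣ a∈W∩A a∈e e∩A⊆⁅a⁆)) ∣W∩A∣≡1+k))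
      (suc-injective (trans (sym (∣p∩q∣≡1+∣p-r∩q∣ b∈W∩B b∈e e∩B⊆⁅b⁆)) ∣W∩B∣≡1+k))
      (α[W-e]≤k α≤1+k unsplit a∈W∩A a∈e b∈W∩B b∈e)

  matchable : ∀ k → Matchable k
  matchable = <-rec Matchable step
    where
    step : ∀ k → (∀ {j} → j < k → Matchable j) → Matchable k
    step zero    _   = matchable-zero
    step (suc k) rec W ∣W∩A∣≡k ∣W∩B∣≡k α≤k with anySubset? (splittingSet? W (suc k))
    ... | yes (_ , splits) = matchable-split rec ∣W∩A∣≡k ∣W∩B∣≡k α≤k splits
    ... | no  unsplit      = matchable-unsplit (rec ≤-refl) ∣W∩A∣≡k ∣W∩B∣≡k α≤k unsplit

  perfectMatching : ∣ A ∣ ≡ ∣ B ∣ → (∀ T → Stable G T → ∣ T ∣ ≤ ∣ A ∣) → ∃ (PerfectMatching G)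
  perfectMatching ∣A∣≡∣B∣ α≤∣A∣
    with matchable ∣ A ∣ ⊤ (cong ∣_∣ (∩-identityˡ A)) (trans (cong ∣_∣ (∩-identityˡ B)) (sym ∣A∣≡∣B∣))
                   (λ T T-stable _ → α≤∣A∣ T T-stable)
  ... | M , matching = M , symmetric , edges , λ v → partner v ∈⊤
    where open IsPerfectMatchingOn matching

m+m≤1+m⇒m≤1 : ∀ m → m + m ≤ suc m → m ≤ 1
m+m≤1+m⇒m≤1 m m+m≤1+m = +-cancelˡ-≤ m m 1 (subst (m + m ≤_) (+-comm 1 m) m+m≤1+m)

p-y≢p-x : ∀ {x y} → x ∈ p → x ≢ y → p ∩ ∁ ⁅ y ⁆ ≢ p ∩ ∁ ⁅ x ⁆
p-y≢p-x {p = p} {x} {y} x∈p x≢y p-y≡p-x = x∈∁p⇒x∉p (proj₂ (x∈p∩q⁻ p _ x∈p-x)) (x∈⁅x⁆ x)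
  where
  x∈p-x : x ∈ p ∩ ∁ ⁅ x ⁆
  x∈p-x = subst (x ∈_) p-y≡p-x (x∈p∩q⁺ (x∈p , x∉p⇒x∈∁p (x≢y ∘ x∈⁅y⁆⇒x≡y y)))

module _ (G : Graph n) where

  Stable-∖uv⇒Stable-v : ∀ {u v T} → Stable (G ∖ (⁅ u ⁆ ∪ ⁅ v ⁆)) T → Stable G (T ∩ ∁ ⁅ v ⁆)
  Stable-∖uv⇒Stable-v {u} {v} {T} T-stable =
    ∖-Stable G (Stable-⊆ (G ∖ (⁅ u ⁆ ∪ ⁅ v ⁆)) (p∩q⊆p T (∁ ⁅ v ⁆)) T-stable) λ x∈T-v y∈T-v x∈e y∈e →
      trans (isU x∈T-v x∈e) (sym (isU y∈T-v y∈e))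
    where
    isU : ∀ {x} → x ∈ T ∩ ∁ ⁅ v ⁆ → x ∈ ⁅ u ⁆ ∪ ⁅ v ⁆ → x ≡ u
    isU x∈T-v x∈e with endpoint x∈e
    ... | inj₁ x≡u  = x≡u
    ... | inj₂ refl = contradiction (x∈⁅x⁆ v) (x∈∁p⇒x∉p (proj₂ (x∈p∩q⁻ T _ x∈T-v)))

  Stable-∖uv⇒Stable-u : ∀ {u v T} → Stable (G ∖ (⁅ u ⁆ ∪ ⁅ v ⁆)) T → Stable G (T ∩ ∁ ⁅ u ⁆)
  Stable-∖uv⇒Stable-u {u} {v} {T} =
    Stable-∖uv⇒Stable-v ∘ subst (λ e → Stable (G ∖ e) T) (∪-comm ⁅ u ⁆ ⁅ v ⁆)

  module _ {A B : Subset n} (bip : IsBipartition G A B) (bis : Bistable G A B) where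

    private
      maxA : MaximumStable G A
      maxA = proj₁ bis
      maxB : MaximumStable G B
      maxB = proj₁ (proj₂ bis)

    ∣A∣≡∣B∣ : ∣ A ∣ ≡ ∣ B ∣
    ∣A∣≡∣B∣ = ≤-antisym (proj₂ maxB A (proj₁ maxA)) (proj₂ maxA B (proj₁ maxB))

    n≡∣A∣+∣A∣ : n ≡ ∣ A ∣ + ∣ A ∣
    n≡∣A∣+∣A∣ = begin
      n                     ≡⟨ ∣⊤∣≡n n ⟨
      ∣ ⊤ {n} ∣             ≡⟨ ∣p∣≡∣p∩q∣+∣p∩r∣ (proj₁ bip) (λ {x} → proj₁ (proj₂ bip) x) ⊤ ⟩
      ∣ ⊤ ∩ A ∣ + ∣ ⊤ ∩ B ∣ ≡⟨ cong₂ (λ p q → ∣ p ∣ + ∣ q ∣) (∩-identityˡ A) (∩-identityˡ B) ⟩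
      ∣ A ∣ + ∣ B ∣         ≡⟨ cong (∣ A ∣ +_) ∣A∣≡∣B∣ ⟨
      ∣ A ∣ + ∣ A ∣         ∎
      where open ≡-Reasoning

    distinctMaximum-cover : ∀ {S₁ S₂} → MaximumStable G S₁ → MaximumStable G S₂ → S₁ ≢ S₂
      → ∀ x → x ∈ S₁ ⊎ x ∈ S₂
    distinctMaximum-cover max₁ max₂ S₁≢S₂ x
      with proj₂ (proj₂ bis) _ max₁ | proj₂ (proj₂ bis) _ max₂ | proj₁ bip x
    ... | inj₁ refl | inj₁ refl | _      = contradiction refl S₁≢S₂
    ... | inj₂ refl | inj₂ refl | _      = contradiction refl S₁≢S₂
    ... | inj₁ refl | inj₂ refl | x∈A⊎B = x∈A⊎B
    ... | inj₂ refl | inj₁ refl | x∈A⊎B = swap-⊎ x∈A⊎B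

    two-endpoints⇒∣T∣≤∣A∣ : 4 ≤ n → ∀ {u v T} → u ≢ v → u ∈ T → v ∈ T
      → Stable G (T ∩ ∁ ⁅ v ⁆) → Stable G (T ∩ ∁ ⁅ u ⁆) → ∣ T ∣ ≤ ∣ A ∣
    two-endpoints⇒∣T∣≤∣A∣ 4≤n {u} {v} {T} u≢v u∈T v∈T T-v-stable T-u-stable with ∣ T ∣ ℕ.≤? ∣ A ∣
    ... | yes ∣T∣≤∣A∣ = ∣T∣≤∣A∣
    ... | no  ∣T∣≰∣A∣ = ⊥-elim (<⇒≱ (s≤s (s≤s (s≤s z≤n))) (begin
      4              ≤⟨ 4≤n ⟩
      n              ≡⟨ n≡∣A∣+∣A∣ ⟩
      ∣ A ∣ + ∣ A ∣  ≤⟨ +-mono-≤ ∣A∣≤1 ∣A∣≤1 ⟩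
      2              ∎))
      where
      open ≤-Reasoning
      ∣T-x∣≡∣A∣ : ∀ {x} → x ∈ T → Stable G (T ∩ ∁ ⁅ x ⁆) → ∣ T ∩ ∁ ⁅ x ⁆ ∣ ≡ ∣ A ∣
      ∣T-x∣≡∣A∣ x∈T T-x-stable = ≤-antisym (proj₂ maxA _ T-x-stable)
        (≤-pred (subst (∣ A ∣ <_) (x∈p⇒∣p∣≡1+∣p-x∣ x∈T) (≰⇒> ∣T∣≰∣A∣)))
      maximum : ∀ {x} → x ∈ T → Stable G (T ∩ ∁ ⁅ x ⁆) → MaximumStable G (T ∩ ∁ ⁅ x ⁆)
      maximum x∈T T-x-stable = T-x-stable , λ S S-stable →
        ≤-trans (proj₂ maxA S S-stable) (≤-reflexive (sym (∣T-x∣≡∣A∣ x∈T T-x-stable)))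
      T-full : ∀ x → x ∈ T
      T-full x = [ proj₁ ∘ x∈p∩q⁻ T _ , proj₁ ∘ x∈p∩q⁻ T _ ]′
        (distinctMaximum-cover (maximum v∈T T-v-stable) (maximum u∈T T-u-stable) (p-y≢p-x u∈T u≢v) x)
      n≤1+∣A∣ : n ≤ suc ∣ A ∣
      n≤1+∣A∣ = begin
        n                     ≡⟨ ∣⊤∣≡n n ⟨
        ∣ ⊤ {n} ∣             ≤⟨ p⊆q⇒∣p∣≤∣q∣ {p = ⊤} (λ {x} _ → T-full x) ⟩
        ∣ T ∣                 ≡⟨ x∈p⇒∣p∣≡1+∣p-x∣ v∈T ⟩
        suc ∣ T ∩ ∁ ⁅ v ⁆ ∣   ≡⟨ cong suc (∣T-x∣≡∣A∣ v∈T T-v-stable) ⟩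
        suc ∣ A ∣             ∎
      ∣A∣≤1 : ∣ A ∣ ≤ 1
      ∣A∣≤1 = m+m≤1+m⇒m≤1 ∣ A ∣ (subst (_≤ suc ∣ A ∣) n≡∣A∣+∣A∣ n≤1+∣A∣)

    α[G∖uv]≤∣A∣ : 4 ≤ n → ∀ {u v} → adj G u v ≡ true
      → ∀ T → Stable (G ∖ (⁅ u ⁆ ∪ ⁅ v ⁆)) T → ∣ T ∣ ≤ ∣ A ∣
    α[G∖uv]≤∣A∣ 4≤n {u} {v} uv T T-stable with v ∈? T | u ∈? T
    ... | no  v∉T | _       =
      ≤-trans (p⊆q⇒∣p∣≤∣q∣ (x∉p⇒p⊆p-x v∉T)) (proj₂ maxA _ (Stable-∖uv⇒Stable-v T-stable))
    ... | yes _   | no  u∉T =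
      ≤-trans (p⊆q⇒∣p∣≤∣q∣ (x∉p⇒p⊆p-x u∉T)) (proj₂ maxA _ (Stable-∖uv⇒Stable-u T-stable))
    ... | yes v∈T | yes u∈T = two-endpoints⇒∣T∣≤∣A∣ 4≤n (λ { refl → irrefl G u uv }) u∈T v∈T
      (Stable-∖uv⇒Stable-v T-stable) (Stable-∖uv⇒Stable-u T-stable)

corollary1 : ∀ {n} (G : Graph n) (A B : Subset n)
    → IsBipartition G A B → Bistable G A B → 4 ≤ n
    → ∀ (u v : Fin n) → adj G u v ≡ true
    → ¬ (∀ (M : Fin n → Fin n → Bool) → PerfectMatching G M → M u v ≡ true)
corollary1 G A B bip bis 4≤n u v uv uv∈every-M
  with König.perfectMatching (G ∖ (⁅ u ⁆ ∪ ⁅ v ⁆)) (∖-bipartition G bip)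
         (∣A∣≡∣B∣ G bip bis) (α[G∖uv]≤∣A∣ G bip bis 4≤n uv)
... | M , M-perfect@(_ , edges , _) =
  ∖-nonadj G (x∈p∪q⁺ (inj₁ (x∈⁅x⁆ u))) (x∈p∪q⁺ (inj₂ (x∈⁅x⁆ v)))
    (edges u v (uv∈every-M M (∖-perfectMatching G M-perfect)))
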